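{- For the game $CSG(\{1,2,4\})$ and every integer $k\ge 0$, $\mathcal{G}(S_{1,1,2,k})$ equals $2$ if $k\equiv 0\pmod 3$, $3$ if $k\equiv 1\pmod 3$, and $1$ if $k\equiv 2\pmod 3$.
   Context: For a set $L$ of positive integers, the game $CSG(L)$ on a connected graph $G$ is the two-player impartial game in which a move consists in removing from the current graph a connected subgraph $H$ such that $|V(H)|\in L$ and the remaining graph is connected (the empty graph counts as connected, so removing the whole graph is allowed when its size is in $L$). The player unable to move loses. $\mathcal{G}(G)$ is the Grundy value of $CSG(\{1,2,4\})$ on $G$. The subdivided star $S_{\ell_1,\ldots,\ell_t}$ is obtained from a central vertex by attaching $t$ disjoint paths with $\ell_1,\ldots,\ell_t$ vertices (paths with $0$ vertices allowed). -}

module Defs where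

open import Data.Nat using (ℕ; zero; suc; _+_; _<_)
open import Data.Fin using (Fin; toℕ)
open import Data.Fin.Subset using (Subset; _∈_; _⊆_; _─_; ∣_∣; ⊤)
open import Data.List using (List; []; _∷_; _++_)
open import Data.Nat.ListAction using (sum)
open import Data.List.Membership.Propositional using () renaming (_∈_ to _∈ˡ_)
open import Data.Product using (Σ; _×_; _,_)
open import Data.Sum using (_⊎_)
open import Relation.Binary.PropositionalEquality using (_≡_; _≢_)

record Graph : Set₁ where
  field
    n   : ℕ
    Adj : Fin n → Fin n → Set
open Graph public

data Reach (G : Graph) (U : Subset (n G)) (u : Fin (n G)) : Fin (n G) → Set where
  here : u ∈ U → Reach G U u u
  step : ∀ {w v} → Reach G U u w → Adj G w v → v ∈ U → Reach G U u v

-- The subgraph induced by U is connected (the empty graph is connected).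
Connected : (G : Graph) → Subset (n G) → Set
Connected G U = ∀ u v → u ∈ U → v ∈ U → Reach G U u v

Move : (G : Graph) → (ℕ → Set) → Subset (n G) → Subset (n G) → Set
Move G L U U' = (U' ⊆ U) × Connected G (U ─ U') × L ∣ U ─ U' ∣ × Connected G U'

data IsGrundy (G : Graph) (L : ℕ → Set) : Subset (n G) → ℕ → Set where
  mex : ∀ {U g}
      → (∀ U' → Move G L U U' → Σ ℕ λ h → IsGrundy G L U' h × h ≢ g)
      → (∀ h → h < g → Σ (Subset (n G)) λ U' → Move G L U U' × IsGrundy G L U' h)
      → IsGrundy G L U g

GrundyValue : (G : Graph) → (ℕ → Set) → ℕ → Set
GrundyValue G L g = IsGrundy G L ⊤ g

L124 : ℕ → Set
L124 m = m ≡ 1 ⊎ m ≡ 2 ⊎ m ≡ 4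

-- Subdivided star S_{ℓ₁,…,ℓ_t}: vertex 0 is the centre; the legs occupy
-- consecutive labels 1.., leg i being a path of ℓ_i vertices attached to 0.
pathEdges : ℕ → ℕ → ℕ → List (ℕ × ℕ)
pathEdges p s zero    = []
pathEdges p s (suc ℓ) = (p , s) ∷ pathEdges s (suc s) ℓ

starEdges : ℕ → List ℕ → List (ℕ × ℕ)
starEdges s []       = []
starEdges s (ℓ ∷ ls) = pathEdges 0 s ℓ ++ starEdges (s + ℓ) ls

SubdividedStar : List ℕ → Graph
SubdividedStar ls = record
  { n   = suc (sum ls)
  ; Adj = λ u v → ((toℕ u , toℕ v) ∈ˡ starEdges 1 ls) ⊎ ((toℕ v , toℕ u) ∈ˡ starEdges 1 ls)
  }

-- Write r = |U| mod 3 for a position U, a connected vertex set of S_{1,1,2,k}.  If U does not contain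
-- all three neighbours v₁, v₂, v₃ of the centre, its Grundy value is r; if it contains this claw, the
-- value is 3, 1, 0 for r = 0, 1, 2 when the tip v₄ of the leg of length 2 is missing and 3, 1, 2 when
-- it is present.  A move removes 1, 2 or 4 ≡ 1 vertices and
-- can only lose the claw or the tip, and a finite table shows that the value always changes, except
-- when a tipless claw of residue 2 loses its claw to a two-vertex removal.  That move does not exist:
-- the removed pair, being connected, would consist of a leaf of the claw and the centre, which
-- isolates the two remaining leaves.  Conversely, each smaller value is reached by deleting a pendant
-- vertex (v₁, v₄ or the end of the long leg) or a pendant edge (v₄v₃ or the last two vertices of the
-- long leg).  The whole star is a claw with tip and k + 5 vertices.

module Submission where

open import Defs
open import Data.Bool using (Bool; true; false; _∧_)
open import Data.Empty using (⊥; ⊥-elim)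
open import Data.Fin using (Fin; zero; suc; toℕ; fromℕ<; _≟_)
open import Data.Fin.Properties using (toℕ-injective; toℕ-fromℕ<; toℕ<n)
open import Data.Fin.Subset using (Subset; _∈_; _∉_; _⊆_; _─_; _-_; ∣_∣; ⁅_⁆; ⊤; Nonempty) renaming (⊥ to ∅)
open import Data.Fin.Subset.Properties
  using (p─⊥≡p; ∉⊥; _∈?_; x∈p∧x∉q⇒x∈p─q; x∈p∧x≢y⇒x∈p-y; p─q⊆p; drop-∷-⊆; x∈⁅x⁆; x∈⁅y⁆⇒x≡y; ∣⁅x⁆∣≡1;
         ∣⊥∣≡0; ∈⊤; ∣⊤∣≡n)
open import Data.List using (_∷_; [])
import Data.List.Relation.Unary.Any as Any
open import Data.List.Membership.Propositional using () renaming (_∈_ to _∈ˡ_)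
open import Data.List.Membership.Propositional.Properties using (∈-++⁻; ∈-++⁺ˡ)
open import Data.Nat using (ℕ; zero; suc; _+_; _≤_; _<_; z≤n; s≤s; _≤?_) renaming (_≟_ to _≟ℕ_)
open import Data.Nat.DivMod using (_%_; [m+kn]%n≡m%n)
open import Data.Nat.Induction using (<-wellFounded)
open import Data.Nat.Properties
  using (+-suc; +-comm; +-identityʳ; +-cancelʳ-≡; +-monoˡ-≤; +-monoʳ-≤; suc-injective; 1+n≢0;
         ≤-refl; ≤-trans; n≤1+n; n≮0; n≮n; ≤∧≢⇒<; ≰⇒>; <⇒≤pred)
open import Data.Product using (∃-syntax; Σ-syntax; _×_; _,_; proj₁)
open import Data.Sum using (_⊎_; inj₁; inj₂; swap; map)
open import Data.Vec using ([]; _∷_; here; there)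
open import Function.Base using (case_of_)
open import Induction.WellFounded using (Acc; acc)
open import Relation.Binary.Definitions using (Symmetric)
open import Relation.Binary.PropositionalEquality
  using (_≡_; _≢_; refl; sym; trans; cong; subst; module ≡-Reasoning)
open import Relation.Nullary using (¬_; yes; no)

-- Finite subsets

x∈p─q⇒x∉q : ∀ {m} {p q : Subset m} {x} → x ∈ p ─ q → x ∉ q
x∈p─q⇒x∉q {p = _ ∷ _} {q = true ∷ _} {x = zero} () here
x∈p─q⇒x∉q {p = _ ∷ _} {q = _ ∷ _} (there x∈p─q) (there x∈q) = x∈p─q⇒x∉q x∈p─q x∈q

x∈p-y⇒x≢y : ∀ {m} {p : Subset m} {x y} → x ∈ p - y → x ≢ y
x∈p-y⇒x≢y x∈p-y refl = x∈p─q⇒x∉q x∈p-y (x∈⁅x⁆ _)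

∣p─q∣+∣q∣≡∣p∣ : ∀ {m} {p q : Subset m} → q ⊆ p → ∣ p ─ q ∣ + ∣ q ∣ ≡ ∣ p ∣
∣p─q∣+∣q∣≡∣p∣ {p = []}       {[]}       _   = refl
∣p─q∣+∣q∣≡∣p∣ {p = true ∷ p} {true ∷ q} q⊆p = trans (+-suc _ _) (cong suc (∣p─q∣+∣q∣≡∣p∣ (drop-∷-⊆ q⊆p)))
∣p─q∣+∣q∣≡∣p∣ {p = true ∷ p} {false ∷ q} q⊆p = cong suc (∣p─q∣+∣q∣≡∣p∣ (drop-∷-⊆ q⊆p))
∣p─q∣+∣q∣≡∣p∣ {p = false ∷ p} {true ∷ q} q⊆p with q⊆p here
... | ()
∣p─q∣+∣q∣≡∣p∣ {p = false ∷ p} {false ∷ q} q⊆p = ∣p─q∣+∣q∣≡∣p∣ (drop-∷-⊆ q⊆p)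

∣p-x∣ : ∀ {m} {p : Subset m} {x} → x ∈ p → suc ∣ p - x ∣ ≡ ∣ p ∣
∣p-x∣ {p = p} {x} x∈p = begin
  suc ∣ p - x ∣          ≡⟨ +-comm 1 _ ⟩
  ∣ p - x ∣ + 1          ≡⟨ cong (∣ p - x ∣ +_) (∣⁅x⁆∣≡1 x) ⟨
  ∣ p - x ∣ + ∣ ⁅ x ⁆ ∣  ≡⟨ ∣p─q∣+∣q∣≡∣p∣ (λ y∈⁅x⁆ → subst (_∈ p) (sym (x∈⁅y⁆⇒x≡y x y∈⁅x⁆)) x∈p) ⟩
  ∣ p ∣                  ∎
  where open ≡-Reasoning

∣p-x-y∣ : ∀ {m} {p : Subset m} {x y} → x ∈ p → y ∈ p - x → 2 + ∣ p - x - y ∣ ≡ ∣ p ∣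
∣p-x-y∣ x∈p y∈p-x = trans (cong suc (∣p-x∣ y∈p-x)) (∣p-x∣ x∈p)

∣x∷p∣≤1+∣p∣ : ∀ {m} x (p : Subset m) → ∣ x ∷ p ∣ ≤ suc ∣ p ∣
∣x∷p∣≤1+∣p∣ true  p = ≤-refl
∣x∷p∣≤1+∣p∣ false p = n≤1+n _

nonempty : ∀ {m} {p : Subset m} → 1 ≤ ∣ p ∣ → Nonempty p
nonempty {p = true ∷ p}  _ = zero , here
nonempty {p = false ∷ p} 1≤∣p∣ with nonempty 1≤∣p∣
... | x , x∈p = suc x , there x∈p

another : ∀ {m} {p : Subset m} {x} → x ∈ p → 2 ≤ ∣ p ∣ → ∃[ y ] y ∈ p × y ≢ x
another {p = p} {x} x∈p 2≤∣p∣ with subst (2 ≤_) (sym (∣p-x∣ x∈p)) 2≤∣p∣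
... | s≤s 1≤∣p-x∣ with nonempty 1≤∣p-x∣
...   | y , y∈p-x = y , p─q⊆p p ⁅ x ⁆ y∈p-x , x∈p-y⇒x≢y y∈p-x

three-elements : ∀ {m} {p : Subset m} {x y z} → x ∈ p → y ∈ p → z ∈ p → x ≢ y → x ≢ z → y ≢ z → 3 ≤ ∣ p ∣
three-elements {p = p} {x} {y} {z} x∈p y∈p z∈p x≢y x≢z y≢z =
  subst (3 ≤_) ∣p∣≡3+ (s≤s (s≤s (s≤s z≤n)))
  where
  y∈p-x : y ∈ p - x
  y∈p-x = x∈p∧x≢y⇒x∈p-y y∈p (λ y≡x → x≢y (sym y≡x))
  z∈p-x-y : z ∈ p - x - y
  z∈p-x-y = x∈p∧x≢y⇒x∈p-y (x∈p∧x≢y⇒x∈p-y z∈p (λ z≡x → x≢z (sym z≡x))) (λ z≡y → y≢z (sym z≡y))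
  ∣p∣≡3+ : 3 + ∣ p - x - y - z ∣ ≡ ∣ p ∣
  ∣p∣≡3+ = trans (cong (2 +_) (∣p-x∣ z∈p-x-y)) (trans (cong suc (∣p-x∣ y∈p-x)) (∣p-x∣ x∈p))

maxElement : ∀ {m} {p : Subset m} → 1 ≤ ∣ p ∣ → ∃[ j ] j ∈ p × (∀ {i} → i ∈ p → toℕ i ≤ toℕ j)
maxElement {p = b ∷ p} 1≤∣p∣ with 1 ≤? ∣ p ∣
... | yes 1≤∣p∣′ with maxElement 1≤∣p∣′
...   | j , j∈p , max = suc j , there j∈p , below
  where
  below : ∀ {i} → i ∈ b ∷ p → toℕ i ≤ suc (toℕ j)
  below {zero}  _           = z≤n
  below {suc i} (there i∈p) = s≤s (max i∈p)
maxElement {p = true ∷ p} _ | no 1≰∣p∣ = zero , here , below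
  where
  below : ∀ {i} → i ∈ true ∷ p → toℕ i ≤ 0
  below {zero}  _           = z≤n
  below {suc i} (there i∈p) = ⊥-elim (1≰∣p∣ (subst (1 ≤_) (∣p-x∣ i∈p) (s≤s z≤n)))
maxElement {p = false ∷ p} 1≤∣p∣ | no 1≰∣p∣ = ⊥-elim (1≰∣p∣ 1≤∣p∣)

∈p─[p-x]⇒≡x : ∀ {m} {p : Subset m} {x y} → y ∈ p ─ (p - x) → y ≡ x
∈p─[p-x]⇒≡x {p = p} {x} {y} y∈ with y ≟ x
... | yes y≡x = y≡x
... | no  y≢x = ⊥-elim (x∈p─q⇒x∉q y∈ (x∈p∧x≢y⇒x∈p-y (p─q⊆p p _ y∈) y≢x))

∈p─[p-x-y]⇒≡x⊎≡y : ∀ {m} {p : Subset m} {x y z} → z ∈ p ─ (p - x - y) → z ≡ x ⊎ z ≡ y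
∈p─[p-x-y]⇒≡x⊎≡y {p = p} {x} {y} {z} z∈ with z ≟ x | z ≟ y
... | yes z≡x | _        = inj₁ z≡x
... | no  _   | yes z≡y  = inj₂ z≡y
... | no  z≢x | no  z≢y  =
  ⊥-elim (x∈p─q⇒x∉q z∈ (x∈p∧x≢y⇒x∈p-y (x∈p∧x≢y⇒x∈p-y (p─q⊆p p _ z∈) z≢x) z≢y))

-- Reachability and connectivity

Pendant : (G : Graph) → Subset (n G) → Fin (n G) → Fin (n G) → Set
Pendant G U x p = ∀ {v} → Adj G x v → v ∈ U → v ≡ p

module _ {G : Graph} {U : Subset (n G)} where

  Reach-target : ∀ {u v} → Reach G U u v → v ∈ U
  Reach-target (here v∈U)     = v∈U
  Reach-target (step _ _ v∈U) = v∈U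

  Reach-trans : ∀ {u v w} → Reach G U u v → Reach G U v w → Reach G U u w
  Reach-trans r (here _)       = r
  Reach-trans r (step s a w∈U) = step (Reach-trans r s) a w∈U

  Reach-firstStep : ∀ {u v} → Reach G U u v → v ≡ u ⊎ ∃[ w ] Adj G u w × w ∈ U
  Reach-firstStep (here _) = inj₁ refl
  Reach-firstStep (step r a w∈U) with Reach-firstStep r
  ... | inj₁ refl  = inj₂ (_ , a , w∈U)
  ... | inj₂ first = inj₂ first

module _ {G : Graph} (Adj-sym : Symmetric (Adj G)) where

  Reach-sym : ∀ {U u v} → Reach G U u v → Reach G U v u
  Reach-sym (here u∈U)     = here u∈U
  Reach-sym (step r a v∈U) = Reach-trans (step (here v∈U) (Adj-sym a) (Reach-target r)) (Reach-sym r)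

  connected-fromRoot : ∀ {U} r → (∀ {v} → v ∈ U → Reach G U r v) → Connected G U
  connected-fromRoot r reach u v u∈U v∈U = Reach-trans (Reach-sym (reach u∈U)) (reach v∈U)

  connected-removePendant : ∀ {U x p} → Connected G U → p ≢ x → Pendant G U x p → Connected G (U - x)
  connected-removePendant {U} {x} {p} conn p≢x pendant a b a∈ b∈ =
    proj₁ (avoid a∈ (conn a b (p─q⊆p U _ a∈) (p─q⊆p U _ b∈))) (x∈p-y⇒x≢y b∈)
    where
    avoid : ∀ {a v} → a ∈ U - x → Reach G U a v
          → (v ≢ x → Reach G (U - x) a v) × (v ≡ x → Reach G (U - x) a p)
    avoid a∈ (here _) = (λ _ → here a∈) , (λ { refl → ⊥-elim (x∈p-y⇒x≢y a∈ refl) })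
    avoid {a} a∈ (step {w} r adj v∈U) with avoid a∈ r | w ≟ x
    ... | _ , to-p | yes refl =
          (λ _ → subst (Reach G (U - x) a) (sym (pendant adj v∈U)) (to-p refl))
        , (λ v≡x → ⊥-elim (p≢x (trans (sym (pendant adj v∈U)) v≡x)))
    ... | to-w , _ | no w≢x =
          (λ v≢x → step (to-w w≢x) adj (x∈p∧x≢y⇒x∈p-y v∈U v≢x))
        , (λ { refl → subst (Reach G (U - x) a) (pendant (Adj-sym adj) (Reach-target r)) (to-w w≢x) })

  neighbourIn : ∀ {U x} → Connected G U → x ∈ U → 2 ≤ ∣ U ∣ → ∃[ v ] Adj G x v × v ∈ U
  neighbourIn conn x∈U 2≤∣U∣ with another x∈U 2≤∣U∣
  ... | y , y∈U , y≢x with Reach-firstStep (conn _ y x∈U y∈U)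
  ...   | inj₁ y≡x = ⊥-elim (y≢x y≡x)
  ...   | inj₂ next = next

-- Moves, and Grundy values from a candidate value function

module _ {G : Graph} {L : ℕ → Set} where

  Move-removeVertex : L 1 → ∀ {U x} → x ∈ U → Connected G (U - x) → Move G L U (U - x)
  Move-removeVertex L1 {U} {x} x∈U conn = p─q⊆p U _ , single , subst L (sym ∣removed∣) L1 , conn
    where
    single : Connected G (U ─ (U - x))
    single a b a∈ b∈ with ∈p─[p-x]⇒≡x a∈ | ∈p─[p-x]⇒≡x b∈
    ... | refl | refl = here a∈
    ∣removed∣ : ∣ U ─ (U - x) ∣ ≡ 1
    ∣removed∣ = +-cancelʳ-≡ ∣ U - x ∣ _ 1 (trans (∣p─q∣+∣q∣≡∣p∣ (p─q⊆p U _)) (sym (∣p-x∣ x∈U)))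

  Move-removeEdge : Symmetric (Adj G) → L 2 → ∀ {U x y} → x ∈ U → y ∈ U → x ≢ y → Adj G x y
    → Connected G (U - x - y) → Move G L U (U - x - y)
  Move-removeEdge Adj-sym L2 {U} {x} {y} x∈U y∈U x≢y adj conn =
    U-x-y⊆U , edge , subst L (sym ∣removed∣) L2 , conn
    where
    U-x-y⊆U : U - x - y ⊆ U
    U-x-y⊆U z∈ = p─q⊆p U _ (p─q⊆p (U - x) _ z∈)
    x∈removed : x ∈ U ─ (U - x - y)
    x∈removed = x∈p∧x∉q⇒x∈p─q x∈U (λ x∈ → x∈p-y⇒x≢y (p─q⊆p (U - x) _ x∈) refl)
    y∈removed : y ∈ U ─ (U - x - y)
    y∈removed = x∈p∧x∉q⇒x∈p─q y∈U (λ y∈ → x∈p-y⇒x≢y y∈ refl)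
    edge : Connected G (U ─ (U - x - y))
    edge a b a∈ b∈ with ∈p─[p-x-y]⇒≡x⊎≡y a∈ | ∈p─[p-x-y]⇒≡x⊎≡y b∈
    ... | inj₁ refl | inj₁ refl = here a∈
    ... | inj₂ refl | inj₂ refl = here a∈
    ... | inj₁ refl | inj₂ refl = step (here x∈removed) adj y∈removed
    ... | inj₂ refl | inj₁ refl = step (here y∈removed) (Adj-sym adj) x∈removed
    ∣removed∣ : ∣ U ─ (U - x - y) ∣ ≡ 2
    ∣removed∣ = +-cancelʳ-≡ ∣ U - x - y ∣ _ 2 (trans (∣p─q∣+∣q∣≡∣p∣ U-x-y⊆U)
      (sym (trans (cong suc (∣p-x∣ (x∈p∧x≢y⇒x∈p-y y∈U (λ y≡x → x≢y (sym y≡x))))) (∣p-x∣ x∈U))))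

  Move-removeAll : ∀ {U} → Connected G U → L ∣ U ∣ → Move G L U ∅
  Move-removeAll {U} conn L∣U∣ =
    (λ x∈∅ → ⊥-elim (∉⊥ x∈∅)) , subst (Connected G) (sym (p─⊥≡p U)) conn ,
    subst L (cong ∣_∣ (sym (p─⊥≡p U))) L∣U∣ , (λ _ _ u∈∅ _ → ⊥-elim (∉⊥ u∈∅))

  module _ (L-positive : ∀ {m} → L m → 1 ≤ m) where

    Move-shrinks : ∀ {U U′} → Move G L U U′ → ∣ U′ ∣ < ∣ U ∣
    Move-shrinks {U′ = U′} (U′⊆U , _ , L∣removed∣ , _) =
      subst (∣ U′ ∣ <_) (∣p─q∣+∣q∣≡∣p∣ U′⊆U) (+-monoˡ-≤ ∣ U′ ∣ (L-positive L∣removed∣))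

    isGrundy-byValue : (value : Subset (n G) → ℕ)
      → (∀ {U U′} → Move G L U U′ → value U′ ≢ value U)
      → (∀ {U} → Connected G U → ∀ {h} → h < value U → ∃[ U′ ] Move G L U U′ × value U′ ≡ h)
      → ∀ {U} → Connected G U → IsGrundy G L U (value U)
    isGrundy-byValue value differs attains {U} = go U (<-wellFounded ∣ U ∣)
      where
      go : ∀ U → Acc _<_ ∣ U ∣ → Connected G U → IsGrundy G L U (value U)
      go U (acc smaller) conn = mex excluded attained
        where
        option : ∀ {U′} → Move G L U U′ → IsGrundy G L U′ (value U′)
        option mv@(_ , _ , _ , conn′) = go _ (smaller (Move-shrinks mv)) conn′
        excluded : ∀ U′ → Move G L U U′ → ∃[ h ] IsGrundy G L U′ h × h ≢ value U
        excluded U′ mv = value U′ , option mv , differs mv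
        attained : ∀ h → h < value U → ∃[ U′ ] Move G L U U′ × IsGrundy G L U′ h
        attained h h< with attains conn h<
        ... | U′ , mv , refl = U′ , mv , option mv

module _ {G : Graph} {L : ℕ → Set} where

  pendant-survives-twoRemoval : ∀ {U U′ x y z c} → Move G L U U′ → ∣ U ─ U′ ∣ ≡ 2
    → x ∈ U ─ U′ → y ∈ U → z ∈ U → x ≢ y → x ≢ z → y ≢ z → x ≢ c → y ≢ c → z ≢ c
    → Pendant G U x c → Pendant G U y c → ⊥
  pendant-survives-twoRemoval {U} {U′} {x} {y} {z} {c} (U′⊆U , R-conn , _ , U′-conn) ∣R∣≡2 x∈R y∈U z∈U
                       x≢y x≢z y≢z x≢c y≢c z≢c x-pendant y-pendant = y-isolated
    where
    c∈R : c ∈ U ─ U′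
    c∈R with another x∈R (subst (2 ≤_) (sym ∣R∣≡2) ≤-refl)
    ... | w , w∈R , w≢x with Reach-firstStep (R-conn x w x∈R w∈R)
    ...   | inj₁ w≡x             = ⊥-elim (w≢x w≡x)
    ...   | inj₂ (v , adj , v∈R) = subst (_∈ U ─ U′) (x-pendant adj (p─q⊆p U U′ v∈R)) v∈R
    survives : ∀ {t} → t ∈ U → t ≢ x → t ≢ c → t ∈ U′
    survives {t} t∈U t≢x t≢c with t ∈? U′
    ... | yes t∈U′ = t∈U′
    ... | no  t∉U′ with subst (3 ≤_) ∣R∣≡2
          (three-elements x∈R c∈R (x∈p∧x∉q⇒x∈p─q t∈U t∉U′) x≢c (λ x≡t → t≢x (sym x≡t)) (λ c≡t → t≢c (sym c≡t)))
    ...   | s≤s (s≤s ())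
    y-isolated : ⊥
    y-isolated with Reach-firstStep (U′-conn y z (survives y∈U (λ y≡x → x≢y (sym y≡x)) y≢c)
                                                  (survives z∈U (λ z≡x → x≢z (sym z≡x)) z≢c))
    ... | inj₁ z≡y = y≢z (sym z≡y)
    ... | inj₂ (v , adj , v∈U′) = x∈p─q⇒x∉q c∈R (subst (_∈ U′) (y-pendant adj (U′⊆U v∈U′)) v∈U′)

-- The subdivided star S_{1,1,2,k}

Star : ℕ → Graph
Star k = SubdividedStar (1 ∷ 1 ∷ 2 ∷ k ∷ [])

Position : ℕ → Set
Position k = Subset (n (Star k))

data Edge : ℕ → ℕ → Set where
  e₀₁  : Edge 0 1
  e₀₂  : Edge 0 2
  e₀₃  : Edge 0 3
  e₃₄  : Edge 3 4
  e₀₅  : Edge 0 5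
  eleg : ∀ j → Edge (5 + j) (6 + j)

Edge± : ℕ → ℕ → Set
Edge± a b = Edge a b ⊎ Edge b a

pathEdge-shape : ∀ {a b} p s ℓ → (a , b) ∈ˡ pathEdges p s ℓ
               → (a ≡ p × b ≡ s) ⊎ ∃[ j ] a ≡ s + j × b ≡ suc (s + j)
pathEdge-shape p s (suc ℓ) (Any.here refl) = inj₁ (refl , refl)
pathEdge-shape p s (suc ℓ) (Any.there e) with pathEdge-shape s (suc s) ℓ e
... | inj₁ (refl , refl)     = inj₂ (0 , sym (+-identityʳ s) , cong suc (sym (+-identityʳ s)))
... | inj₂ (j , refl , refl) = inj₂ (suc j , sym (+-suc s j) , cong suc (sym (+-suc s j)))

starEdge⇒Edge : ∀ {k a b} → (a , b) ∈ˡ starEdges 1 (1 ∷ 1 ∷ 2 ∷ k ∷ []) → Edge a b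
starEdge⇒Edge (Any.here refl)                                   = e₀₁
starEdge⇒Edge (Any.there (Any.here refl))                       = e₀₂
starEdge⇒Edge (Any.there (Any.there (Any.here refl)))           = e₀₃
starEdge⇒Edge (Any.there (Any.there (Any.there (Any.here refl)))) = e₃₄
starEdge⇒Edge {k} (Any.there (Any.there (Any.there (Any.there e)))) with ∈-++⁻ (pathEdges 0 5 k) e
... | inj₂ ()
... | inj₁ e′ with pathEdge-shape 0 5 k e′
...   | inj₁ (refl , refl)     = e₀₅
...   | inj₂ (j , refl , refl) = eleg j

Edge±-irrefl : ∀ {a} → ¬ Edge± a a
Edge±-irrefl (inj₁ ())
Edge±-irrefl (inj₂ ())

Edge±-from₁ : ∀ {b} → Edge± 1 b → b ≡ 0
Edge±-from₁ (inj₂ e₀₁) = refl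

Edge±-from₂ : ∀ {b} → Edge± 2 b → b ≡ 0
Edge±-from₂ (inj₂ e₀₂) = refl

Edge±-from₃ : ∀ {b} → Edge± 3 b → b ≡ 0 ⊎ b ≡ 4
Edge±-from₃ (inj₁ e₃₄) = inj₂ refl
Edge±-from₃ (inj₂ e₀₃) = inj₁ refl

Edge±-from₄ : ∀ {b} → Edge± 4 b → b ≡ 3
Edge±-from₄ (inj₂ e₃₄) = refl

Edge±-fromLeg : ∀ {t b} → Edge± (5 + t) b
              → (t ≡ 0 × b ≡ 0) ⊎ ∃[ s ] b ≡ 5 + s × (suc s ≡ t ⊎ s ≡ suc t)
Edge±-fromLeg (inj₁ (eleg j)) = inj₂ (suc j , refl , inj₂ refl)
Edge±-fromLeg (inj₂ e₀₅)      = inj₁ (refl , refl)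
Edge±-fromLeg (inj₂ (eleg j)) = inj₂ (j , refl , inj₁ refl)

-- Labels as in SubdividedStar: v₀ is the centre, v₁ and v₂ are the legs of length 1, v₃ v₄ the leg of
-- length 2 with tip v₄, and leg j is the vertex 5 + j of the long leg.
module _ {k : ℕ} where

  v₀ v₁ v₂ v₃ v₄ : Fin (n (Star k))
  v₀ = zero
  v₁ = suc zero
  v₂ = suc (suc zero)
  v₃ = suc (suc (suc zero))
  v₄ = suc (suc (suc (suc zero)))

leg : ∀ {k} → Fin (k + 0) → Fin (n (Star k))
leg j = suc (suc (suc (suc (suc j))))

module _ {k : ℕ} where

  Adj⇒Edge± : ∀ {u v} → Adj (Star k) u v → Edge± (toℕ u) (toℕ v)
  Adj⇒Edge± = map starEdge⇒Edge starEdge⇒Edge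

  Adj-sym : Symmetric (Adj (Star k))
  Adj-sym = swap

  Adj⇒≢ : ∀ {u v} → Adj (Star k) u v → v ≢ u
  Adj⇒≢ a refl = Edge±-irrefl (Adj⇒Edge± a)

  Adj-v₁ : ∀ {v} → Adj (Star k) v₁ v → v ≡ v₀
  Adj-v₁ a = toℕ-injective (Edge±-from₁ (Adj⇒Edge± a))

  Adj-v₂ : ∀ {v} → Adj (Star k) v₂ v → v ≡ v₀
  Adj-v₂ a = toℕ-injective (Edge±-from₂ (Adj⇒Edge± a))

  Adj-v₃ : ∀ {v} → Adj (Star k) v₃ v → v ≡ v₀ ⊎ v ≡ v₄
  Adj-v₃ a = map toℕ-injective toℕ-injective (Edge±-from₃ (Adj⇒Edge± a))

  Adj-v₄ : ∀ {v} → Adj (Star k) v₄ v → v ≡ v₃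
  Adj-v₄ a = toℕ-injective (Edge±-from₄ (Adj⇒Edge± a))

  legOf : ∀ (v : Fin (n (Star k))) {s} → toℕ v ≡ 5 + s → ∃[ j ] v ≡ leg j × toℕ j ≡ s
  legOf (suc (suc (suc (suc (suc j))))) refl = j , refl , refl
  legOf zero                          ()
  legOf (suc zero)                    ()
  legOf (suc (suc zero))              ()
  legOf (suc (suc (suc zero)))        ()
  legOf (suc (suc (suc (suc zero))))  ()

  LegNeighbour : Fin (k + 0) → Fin (n (Star k)) → Set
  LegNeighbour i v = (toℕ i ≡ 0 × v ≡ v₀) ⊎ ∃[ j ] v ≡ leg j × (suc (toℕ j) ≡ toℕ i ⊎ toℕ j ≡ suc (toℕ i))

  Adj-leg : ∀ {i v} → Adj (Star k) (leg i) v → LegNeighbour i v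
  Adj-leg {v = v} a with Edge±-fromLeg (Adj⇒Edge± a)
  ... | inj₁ (i≡0 , v≡0)       = inj₁ (i≡0 , toℕ-injective v≡0)
  ... | inj₂ (s , v≡5+s , adj) with legOf v v≡5+s
  ...   | j , refl , refl      = inj₂ (j , refl , adj)

  v₀-v₁ : Adj (Star k) v₀ v₁
  v₀-v₁ = inj₁ (Any.here refl)

  v₀-v₂ : Adj (Star k) v₀ v₂
  v₀-v₂ = inj₁ (Any.there (Any.here refl))

  v₀-v₃ : Adj (Star k) v₀ v₃
  v₀-v₃ = inj₁ (Any.there (Any.there (Any.here refl)))

  v₃-v₄ : Adj (Star k) v₃ v₄
  v₃-v₄ = inj₁ (Any.there (Any.there (Any.there (Any.here refl))))

v₀-leg : ∀ {k} (i : Fin (k + 0)) → toℕ i ≡ 0 → Adj (Star k) v₀ (leg i)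
v₀-leg {suc k} i i≡0 rewrite i≡0 = inj₁ (Any.there (Any.there (Any.there (Any.there (Any.here refl)))))

pathEdge-member : ∀ p s ℓ t → 2 + t ≤ ℓ → (s + t , suc (s + t)) ∈ˡ pathEdges p s ℓ
pathEdge-member p s (suc (suc ℓ)) zero    _         rewrite +-identityʳ s = Any.there (Any.here refl)
pathEdge-member p s (suc ℓ)       (suc t) (s≤s 2+t≤ℓ) rewrite +-suc s t =
  Any.there (pathEdge-member s (suc s) ℓ t 2+t≤ℓ)

leg-leg : ∀ {k} (i j : Fin (k + 0)) → toℕ j ≡ suc (toℕ i) → Adj (Star k) (leg i) (leg j)
leg-leg {k} i j j≡1+i rewrite j≡1+i =
  inj₁ (Any.there (Any.there (Any.there (Any.there (∈-++⁺ˡ (pathEdge-member 0 5 k (toℕ i) 2+i≤k))))))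
  where
  2+i≤k : 2 + toℕ i ≤ k
  2+i≤k = subst (2 + toℕ i ≤_) (+-identityʳ k) (subst (λ t → suc t ≤ k + 0) j≡1+i (toℕ<n j))

reach-leg : ∀ {k} t (i : Fin (k + 0)) → toℕ i ≡ t → Reach (Star k) ⊤ v₀ (leg i)
reach-leg zero    i i≡0   = step (here ∈⊤) (v₀-leg i i≡0) ∈⊤
reach-leg {k} (suc t) i i≡1+t =
  step (reach-leg t i′ (toℕ-fromℕ< t<k)) (leg-leg i′ i (trans i≡1+t (cong suc (sym (toℕ-fromℕ< t<k))))) ∈⊤
  where
  t<k : t < k + 0
  t<k = ≤-trans (n≤1+n (suc t)) (subst (_< k + 0) i≡1+t (toℕ<n i))
  i′ = fromℕ< t<k

reach-from-v₀ : ∀ {k} v → Reach (Star k) ⊤ v₀ v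
reach-from-v₀ zero                                = here ∈⊤
reach-from-v₀ (suc zero)                          = step (here ∈⊤) v₀-v₁ ∈⊤
reach-from-v₀ (suc (suc zero))                    = step (here ∈⊤) v₀-v₂ ∈⊤
reach-from-v₀ (suc (suc (suc zero)))              = step (here ∈⊤) v₀-v₃ ∈⊤
reach-from-v₀ (suc (suc (suc (suc zero))))        = step (step (here ∈⊤) v₀-v₃ ∈⊤) v₃-v₄ ∈⊤
reach-from-v₀ (suc (suc (suc (suc (suc i)))))     = reach-leg (toℕ i) i refl

Star-connected : ∀ {k} → Connected (Star k) ⊤
Star-connected = connected-fromRoot Adj-sym v₀ (λ {v} _ → reach-from-v₀ v)

module _ {k : ℕ} {U : Position k} where

  v₁-pendant : Pendant (Star k) U v₁ v₀
  v₁-pendant adj _ = Adj-v₁ adj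

  v₂-pendant : Pendant (Star k) U v₂ v₀
  v₂-pendant adj _ = Adj-v₂ adj

  v₄-pendant : Pendant (Star k) U v₄ v₃
  v₄-pendant adj _ = Adj-v₄ adj

  v₃-pendant : v₄ ∉ U → Pendant (Star k) U v₃ v₀
  v₃-pendant v₄∉U adj v∈U with Adj-v₃ adj
  ... | inj₁ v≡v₀ = v≡v₀
  ... | inj₂ refl = ⊥-elim (v₄∉U v∈U)

-- The candidate Grundy value

mod3 : ℕ → ℕ
mod3 0                   = 0
mod3 1                   = 1
mod3 2                   = 2
mod3 (suc (suc (suc s))) = mod3 s

mod3≡%3 : ∀ s → mod3 s ≡ s % 3
mod3≡%3 0                   = refl
mod3≡%3 1                   = refl
mod3≡%3 2                   = refl
mod3≡%3 (suc (suc (suc s))) = trans (mod3≡%3 s) (sym (trans (cong (_% 3) (+-comm 3 s)) ([m+kn]%n≡m%n s 1 3)))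

mod3≢3+ : ∀ s {r} → mod3 s ≢ 3 + r
mod3≢3+ 0                   ()
mod3≢3+ 1                   ()
mod3≢3+ 2                   ()
mod3≢3+ (suc (suc (suc s))) = mod3≢3+ s

-- (r − 1) mod 3 for residues r < 3; the value at r ≥ 3 is junk.
pred3 : ℕ → ℕ
pred3 0 = 2
pred3 1 = 0
pred3 _ = 1

mod3-pred : ∀ {a b r} → suc a ≡ b → mod3 b ≡ r → mod3 a ≡ pred3 r
mod3-pred {a} refl = go a
  where
  go : ∀ s {r} → mod3 (suc s) ≡ r → mod3 s ≡ pred3 r
  go 0                   refl = refl
  go 1                   refl = refl
  go 2                   refl = refl
  go (suc (suc (suc s))) eq   = go s eq

mod3-pred₂ : ∀ {a b r} → 2 + a ≡ b → mod3 b ≡ r → mod3 a ≡ pred3 (pred3 r)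
mod3-pred₂ {a} 2+a≡b ∣b∣≡₃r = mod3-pred {a} refl (mod3-pred 2+a≡b ∣b∣≡₃r)

mod3≡2⇒2≤ : ∀ {s} → mod3 s ≡ 2 → 2 ≤ s
mod3≡2⇒2≤ {suc (suc s)} _ = s≤s (s≤s z≤n)

mod3≡2⇒5≤ : ∀ {s} → mod3 s ≡ 2 → s ≢ 2 → 5 ≤ s
mod3≡2⇒5≤ {2}                         _ s≢2 = ⊥-elim (s≢2 refl)
mod3≡2⇒5≤ {suc (suc (suc (suc (suc s))))} _ _ = s≤s (s≤s (s≤s (s≤s (s≤s z≤n))))

mod3-positive : ∀ {s r} → mod3 s ≡ suc r → 1 ≤ s
mod3-positive {suc s} _ = s≤s z≤n

mod3-2+ : ∀ s → mod3 (2 + s) ≡ mod3 (2 + mod3 s)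
mod3-2+ 0                   = refl
mod3-2+ 1                   = refl
mod3-2+ 2                   = refl
mod3-2+ (suc (suc (suc s))) = mod3-2+ s

claw : ∀ {m} → Subset (5 + m) → Bool
claw (_ ∷ b₁ ∷ b₂ ∷ b₃ ∷ _ ∷ _) = b₁ ∧ b₂ ∧ b₃

tip : ∀ {m} → Subset (5 + m) → Bool
tip (_ ∷ _ ∷ _ ∷ _ ∷ b₄ ∷ _) = b₄

value : Bool → Bool → ℕ → ℕ
value false _     r             = r
value true  _     0             = 3
value true  _     1             = 1
value true  false (suc (suc _)) = 0
value true  true  (suc (suc _)) = 2

grundy : ∀ {m} → Subset (5 + m) → ℕ
grundy U = value (claw U) (tip U) (mod3 ∣ U ∣)

grundy-clawFree : ∀ {m} {U : Subset (5 + m)} → claw U ≡ false → grundy U ≡ mod3 ∣ U ∣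
grundy-clawFree {U = U} clawFree = cong (λ e → value e (tip U) (mod3 ∣ U ∣)) clawFree

claw-mono : ∀ {m} {U U′ : Subset (5 + m)} → U′ ⊆ U → claw U′ ≡ true → claw U ≡ true
claw-mono {U = _ ∷ _ ∷ _ ∷ _ ∷ _ ∷ _} {_ ∷ true ∷ true ∷ true ∷ _ ∷ _} U′⊆U refl
  with U′⊆U (there here) | U′⊆U (there (there here)) | U′⊆U (there (there (there here)))
... | there here | there (there here) | there (there (there here)) = refl

tip-mono : ∀ {m} {U U′ : Subset (5 + m)} → U′ ⊆ U → tip U′ ≡ true → tip U ≡ true
tip-mono {U = _ ∷ _ ∷ _ ∷ _ ∷ _ ∷ _} {_ ∷ _ ∷ _ ∷ _ ∷ true ∷ _} U′⊆U refl
  with U′⊆U (there (there (there (there here))))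
... | there (there (there (there here))) = refl

claw-antimono : ∀ {m} {U U′ : Subset (5 + m)} → U′ ⊆ U → claw U ≡ false → claw U′ ≡ false
claw-antimono {U′ = U′} U′⊆U clawFree with claw U′ in eq
... | false = refl
... | true  with trans (sym (claw-mono U′⊆U eq)) clawFree
...   | ()

pattern one  = inj₁ refl
pattern two  = inj₂ (inj₁ refl)
pattern four = inj₂ (inj₂ refl)

L124-positive : ∀ {m} → L124 m → 1 ≤ m
L124-positive one  = s≤s z≤n
L124-positive two  = s≤s z≤n
L124-positive four = s≤s z≤n

value-clash : ∀ {m} → L124 m → ∀ e b e′ b′ → (e′ ≡ true → e ≡ true) → (b′ ≡ true → b ≡ true) → ∀ s
            → value e b (mod3 (m + s)) ≡ value e′ b′ (mod3 s) → e ≡ true × b ≡ false × e′ ≡ false × m ≡ 2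
-- mod3 (4 + s) computes to mod3 (1 + s): removing four vertices is handled as removing one.
value-clash four e b e′ b′ e′⇒e b′⇒b s eq with value-clash one e b e′ b′ e′⇒e b′⇒b s eq
... | _ , _ , _ , ()
value-clash one e b e′ b′ e′⇒e b′⇒b (suc (suc (suc s))) eq = value-clash one e b e′ b′ e′⇒e b′⇒b s eq
value-clash two e b e′ b′ e′⇒e b′⇒b (suc (suc (suc s))) eq = value-clash two e b e′ b′ e′⇒e b′⇒b s eq
value-clash _ false _ true _ e′⇒e _ _ _ with e′⇒e refl
... | ()
value-clash _ true false true true _ b′⇒b _ _ with b′⇒b refl
... | ()
value-clash one false _     false _     _ _ 0 ()
value-clash one false _     false _     _ _ 1 ()
value-clash one false _     false _     _ _ 2 ()
value-clash two false _     false _     _ _ 0 ()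
value-clash two false _     false _     _ _ 1 ()
value-clash two false _     false _     _ _ 2 ()
value-clash one true  false false _     _ _ 0 ()
value-clash one true  false false _     _ _ 1 ()
value-clash one true  false false _     _ _ 2 ()
value-clash two true  false false _     _ _ 0 refl = refl , refl , refl , refl
value-clash two true  false false _     _ _ 1 ()
value-clash two true  false false _     _ _ 2 ()
value-clash one true  false true  false _ _ 0 ()
value-clash one true  false true  false _ _ 1 ()
value-clash one true  false true  false _ _ 2 ()
value-clash two true  false true  false _ _ 0 ()
value-clash two true  false true  false _ _ 1 ()
value-clash two true  false true  false _ _ 2 ()
value-clash one true  true  false _     _ _ 0 ()
value-clash one true  true  false _     _ _ 1 ()
value-clash one true  true  false _     _ _ 2 ()
value-clash two true  true  false _     _ _ 0 ()
value-clash two true  true  false _     _ _ 1 ()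
value-clash two true  true  false _     _ _ 2 ()
value-clash one true  true  true  false _ _ 0 ()
value-clash one true  true  true  false _ _ 1 ()
value-clash one true  true  true  false _ _ 2 ()
value-clash two true  true  true  false _ _ 0 ()
value-clash two true  true  true  false _ _ 1 ()
value-clash two true  true  true  false _ _ 2 ()
value-clash one true  true  true  true  _ _ 0 ()
value-clash one true  true  true  true  _ _ 1 ()
value-clash one true  true  true  true  _ _ 2 ()
value-clash two true  true  true  true  _ _ 0 ()
value-clash two true  true  true  true  _ _ 1 ()
value-clash two true  true  true  true  _ _ 2 ()

claw-survives : ∀ {k} {U U′ : Position k} → Move (Star k) L124 U U′
              → claw U ≡ true → tip U ≡ false → ∣ U ─ U′ ∣ ≡ 2 → claw U′ ≢ false
claw-survives {U = _ ∷ true ∷ true ∷ true ∷ false ∷ _} {_ ∷ false ∷ _ ∷ _ ∷ _ ∷ _} mv refl refl ∣R∣≡2 _ =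
  pendant-survives-twoRemoval {L = L124} mv ∣R∣≡2 (there here) (there (there here)) (there (there (there here)))
    (λ ()) (λ ()) (λ ()) (λ ()) (λ ()) (λ ()) v₁-pendant v₂-pendant
claw-survives {U = _ ∷ true ∷ true ∷ true ∷ false ∷ _} {_ ∷ true ∷ false ∷ _ ∷ _ ∷ _} mv refl refl ∣R∣≡2 _ =
  pendant-survives-twoRemoval {L = L124} mv ∣R∣≡2 (there (there here)) (there here) (there (there (there here)))
    (λ ()) (λ ()) (λ ()) (λ ()) (λ ()) (λ ()) v₂-pendant v₁-pendant
claw-survives {U = _ ∷ true ∷ true ∷ true ∷ false ∷ _} {_ ∷ true ∷ true ∷ false ∷ _ ∷ _} mv refl refl ∣R∣≡2 _ =
  pendant-survives-twoRemoval {L = L124} mv ∣R∣≡2 (there (there (there here))) (there here) (there (there here))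
    (λ ()) (λ ()) (λ ()) (λ ()) (λ ()) (λ ()) (v₃-pendant λ { (there (there (there (there ())))) }) v₁-pendant
claw-survives {U = _ ∷ true ∷ true ∷ true ∷ false ∷ _} {_ ∷ true ∷ true ∷ true ∷ _ ∷ _} _ refl refl _ ()

grundy-differs : ∀ {k} {U U′ : Position k} → Move (Star k) L124 U U′ → grundy U′ ≢ grundy U
grundy-differs {U = U} {U′} mv@(U′⊆U , _ , L∣R∣ , _) eq
  with value-clash L∣R∣ (claw U) (tip U) (claw U′) (tip U′) (claw-mono U′⊆U) (tip-mono U′⊆U) ∣ U′ ∣
         (trans (cong (λ s → value (claw U) (tip U) (mod3 s)) (∣p─q∣+∣q∣≡∣p∣ U′⊆U)) (sym eq))
... | claw≡true , no-tip , clawFree′ , ∣R∣≡2 = claw-survives mv claw≡true no-tip ∣R∣≡2 clawFree′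

clawFree-size : ∀ {m} b₀ b₁ b₂ b₃ (w : Subset m) → b₁ ∧ b₂ ∧ b₃ ≡ false
              → ∣ b₀ ∷ b₁ ∷ b₂ ∷ b₃ ∷ false ∷ w ∣ ≤ 3 + ∣ w ∣
clawFree-size b₀ b₁ b₂ b₃ w clawFree =
  ≤-trans (∣x∷p∣≤1+∣p∣ b₀ (b₁ ∷ b₂ ∷ b₃ ∷ false ∷ w)) (s≤s (three-bits b₁ b₂ b₃ clawFree))
  where
  three-bits : ∀ b₁ b₂ b₃ → b₁ ∧ b₂ ∧ b₃ ≡ false → ∣ b₁ ∷ b₂ ∷ b₃ ∷ false ∷ w ∣ ≤ 2 + ∣ w ∣
  three-bits false b₂    b₃    _ =
    ≤-trans (∣x∷p∣≤1+∣p∣ b₂ (b₃ ∷ false ∷ w)) (s≤s (∣x∷p∣≤1+∣p∣ b₃ (false ∷ w)))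
  three-bits true  false b₃    _ = s≤s (∣x∷p∣≤1+∣p∣ b₃ (false ∷ w))
  three-bits true  true  false _ = ≤-refl

-- Options realising every smaller value

module _ {k : ℕ} where

  Option : Position k → ℕ → Set
  Option U h = ∃[ U′ ] Move (Star k) L124 U U′ × grundy U′ ≡ h

  Removal : Position k → ℕ → Set
  Removal U d = ∃[ U′ ] Move (Star k) L124 U U′ × d + ∣ U′ ∣ ≡ ∣ U ∣

  removePendant : ∀ {U x p} → Connected (Star k) U → x ∈ U → p ≢ x → Pendant (Star k) U x p
                → Move (Star k) L124 U (U - x)
  removePendant conn x∈U p≢x pendant =
    Move-removeVertex {L = L124} one x∈U (connected-removePendant Adj-sym conn p≢x pendant)

  remove-v₄v₃ : ∀ {U} → Connected (Star k) U → v₄ ∈ U → v₃ ∈ U → Move (Star k) L124 U (U - v₄ - v₃)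
  remove-v₄v₃ conn v₄∈U v₃∈U = Move-removeEdge {L = L124} Adj-sym two v₄∈U v₃∈U (λ ()) (Adj-sym v₃-v₄)
    (connected-removePendant Adj-sym (connected-removePendant Adj-sym conn (λ ()) v₄-pendant) (λ ())
      (v₃-pendant (λ v₄∈U-v₄ → x∈p-y⇒x≢y v₄∈U-v₄ refl)))

  top-leg-pendant : ∀ {U j p} → (∀ {j′} → toℕ j′ ≡ suc (toℕ j) → leg j′ ∉ U)
                  → Adj (Star k) (leg j) p → p ∈ U → Pendant (Star k) U (leg j) p
  top-leg-pendant above∉U adj-p p∈U adj-v v∈U with Adj-leg adj-v | Adj-leg adj-p
  ... | inj₂ (_ , refl , inj₂ up) | _                           = ⊥-elim (above∉U up v∈U)
  ... | _                         | inj₂ (_ , refl , inj₂ up)   = ⊥-elim (above∉U up p∈U)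
  ... | inj₁ (_ , refl)           | inj₁ (_ , refl)             = refl
  ... | inj₁ (j≡0 , _)            | inj₂ (_ , _ , inj₁ down)    = ⊥-elim (1+n≢0 (trans down j≡0))
  ... | inj₂ (_ , _ , inj₁ down)  | inj₁ (j≡0 , _)              = ⊥-elim (1+n≢0 (trans down j≡0))
  ... | inj₂ (_ , refl , inj₁ d₁) | inj₂ (_ , refl , inj₁ d₂)   =
        cong leg (toℕ-injective (suc-injective (trans d₁ (sym d₂))))

  leg-∈⁺ : ∀ {b₀ b₁ b₂ b₃ b₄} {w : Subset (k + 0)} {j} → j ∈ w → leg j ∈ (b₀ ∷ b₁ ∷ b₂ ∷ b₃ ∷ b₄ ∷ w)
  leg-∈⁺ j∈w = there (there (there (there (there j∈w))))

  above-top-∉ : ∀ {b₀ b₁ b₂ b₃ b₄} {w : Subset (k + 0)} {j : Fin (k + 0)} → (∀ {i} → i ∈ w → toℕ i ≤ toℕ j)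
            → ∀ {j′ : Fin (k + 0)} → toℕ j′ ≡ suc (toℕ j) → leg j′ ∉ (b₀ ∷ b₁ ∷ b₂ ∷ b₃ ∷ b₄ ∷ w)
  above-top-∉ {j = j} top j′≡1+j (there (there (there (there (there j′∈w))))) =
    n≮n (toℕ j) (subst (_≤ toℕ j) j′≡1+j (top j′∈w))

  LegRemoval : Position k → Set
  LegRemoval U = Σ[ j ∈ Fin (k + 0) ] leg j ∈ U × Move (Star k) L124 U (U - leg j)

  LegPairRemoval : Position k → Set
  LegPairRemoval U = Σ[ j ∈ Fin (k + 0) ] Σ[ j′ ∈ Fin (k + 0) ]
    leg j ∈ U × leg j′ ∈ U - leg j × Move (Star k) L124 U (U - leg j - leg j′)

  removeTopLeg : ∀ {b₀ b₁ b₂ b₃ b₄} {w : Subset (k + 0)} → let U = b₀ ∷ b₁ ∷ b₂ ∷ b₃ ∷ b₄ ∷ w in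
                 Connected (Star k) U → 2 ≤ ∣ U ∣ → 1 ≤ ∣ w ∣ → LegRemoval U
  removeTopLeg conn 2≤∣U∣ 1≤∣w∣ =
    let (j , j∈w , top)  = maxElement 1≤∣w∣
        (p , adj , p∈U) = neighbourIn Adj-sym conn (leg-∈⁺ j∈w) 2≤∣U∣
    in j , leg-∈⁺ j∈w ,
       removePendant conn (leg-∈⁺ j∈w) (Adj⇒≢ adj) (top-leg-pendant (above-top-∉ top) adj p∈U)

  removeTopLegs : ∀ {b₀ b₁ b₂ b₃ b₄} {w : Subset (k + 0)} → let U = b₀ ∷ b₁ ∷ b₂ ∷ b₃ ∷ b₄ ∷ w in
                  Connected (Star k) U → 3 ≤ ∣ U ∣ → 2 ≤ ∣ w ∣ → LegPairRemoval U
  removeTopLegs {b₀} {b₁} {b₂} {b₃} {b₄} {w} conn 3≤∣U∣ 2≤∣w∣ =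
    let (j , j∈w , top)  = maxElement (≤-trans (s≤s z≤n) 2≤∣w∣)
        (i , i∈w , i≢j)  = another j∈w 2≤∣w∣
        (p , adj , p∈U) = neighbourIn Adj-sym conn (leg-∈⁺ j∈w) (≤-trans (n≤1+n 2) 3≤∣U∣)
    in belowTop j∈w top (≤∧≢⇒< (top i∈w) (λ i≡j → i≢j (toℕ-injective i≡j))) adj p∈U (Adj-leg adj)
    where
    U : Position k
    U = b₀ ∷ b₁ ∷ b₂ ∷ b₃ ∷ b₄ ∷ w
    belowTop : ∀ {i j p} → j ∈ w → (∀ {i} → i ∈ w → toℕ i ≤ toℕ j) → toℕ i < toℕ j
             → Adj (Star k) (leg j) p → p ∈ U → LegNeighbour j p → LegPairRemoval U
    belowTop {i} _ _ i<j _ _ (inj₁ (j≡0 , _)) = ⊥-elim (n≮0 (subst (toℕ i <_) j≡0 i<j))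
    belowTop _ top _ _ p∈U (inj₂ (_ , refl , inj₂ up)) = ⊥-elim (above-top-∉ top up p∈U)
    belowTop {j = j} j∈w top _ adj p∈U (inj₂ (j′ , refl , inj₁ down)) =
      j , j′ , leg-∈⁺ j∈w , j′∈U₁ , Move-removeEdge {L = L124} Adj-sym two (leg-∈⁺ j∈w) p∈U j≢j′ adj conn₂
      where
      U₁ : Position k
      U₁ = U - leg j
      j≢j′ : leg j ≢ leg j′
      j≢j′ j≡j′ = Adj⇒≢ adj (sym j≡j′)
      j′∈U₁ : leg j′ ∈ U₁
      j′∈U₁ = x∈p∧x≢y⇒x∈p-y p∈U (Adj⇒≢ adj)
      conn₁ : Connected (Star k) U₁
      conn₁ = connected-removePendant Adj-sym conn (Adj⇒≢ adj) (top-leg-pendant (above-top-∉ top) adj p∈U)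
      above-j′ : ∀ {j″ : Fin (k + 0)} → toℕ j″ ≡ suc (toℕ j′) → leg j″ ∉ U₁
      above-j′ j″≡1+j′ j″∈U₁ = x∈p-y⇒x≢y j″∈U₁ (cong leg (toℕ-injective (trans j″≡1+j′ down)))
      2≤∣U₁∣ : 2 ≤ ∣ U₁ ∣
      2≤∣U₁∣ = <⇒≤pred (subst (3 ≤_) (sym (∣p-x∣ (leg-∈⁺ {b₀} {b₁} {b₂} {b₃} {b₄} j∈w))) 3≤∣U∣)
      conn₂ : Connected (Star k) (U₁ - leg j′)
      conn₂ = let (q , adj-q , q∈U₁) = neighbourIn Adj-sym conn₁ j′∈U₁ 2≤∣U₁∣
              in connected-removePendant Adj-sym conn₁ (Adj⇒≢ adj-q) (top-leg-pendant above-j′ adj-q q∈U₁)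

  removeAll : ∀ {U d} → Connected (Star k) U → L124 d → ∣ U ∣ ≡ d → Removal U d
  removeAll {d = d} conn L124-d ∣U∣≡d =
    ∅ , Move-removeAll {L = L124} conn (subst L124 (sym ∣U∣≡d) L124-d) ,
    trans (cong (d +_) (∣⊥∣≡0 (n (Star k)))) (trans (+-identityʳ d) (sym ∣U∣≡d))

  removeVertex : ∀ {U x} → x ∈ U → Move (Star k) L124 U (U - x) → Removal U 1
  removeVertex x∈U mv = _ , mv , ∣p-x∣ x∈U

  removeOffLeg : ∀ {b₀ b₁ b₂ b₃ b₄} {w : Subset (k + 0)} → let U = b₀ ∷ b₁ ∷ b₂ ∷ b₃ ∷ b₄ ∷ w in
                 Connected (Star k) U → 2 ≤ ∣ U ∣ → ¬ 1 ≤ ∣ w ∣ → Removal U 1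
  removeOffLeg {b₁ = true} conn _ _ =
    removeVertex (there here) (removePendant conn (there here) (λ ()) v₁-pendant)
  removeOffLeg {b₁ = false} {true} conn _ _ =
    removeVertex (there (there here)) (removePendant conn (there (there here)) (λ ()) v₂-pendant)
  removeOffLeg {b₁ = false} {false} {_} {true} conn _ _ =
    removeVertex v₄∈ (removePendant conn v₄∈ (λ ()) v₄-pendant)
    where v₄∈ = there (there (there (there here)))
  removeOffLeg {b₁ = false} {false} {true} {false} conn _ _ =
    removeVertex v₃∈ (removePendant conn v₃∈ (λ ()) (v₃-pendant λ { (there (there (there (there ())))) }))
    where v₃∈ = there (there (there here))
  removeOffLeg {true}  {false} {false} {false} {false} _ (s≤s 1≤∣w∣) 1≰∣w∣ = ⊥-elim (1≰∣w∣ 1≤∣w∣)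
  removeOffLeg {false} {false} {false} {false} {false} _ 2≤∣w∣ 1≰∣w∣ =
    ⊥-elim (1≰∣w∣ (≤-trans (n≤1+n 1) 2≤∣w∣))

  removeOne : ∀ {U} → Connected (Star k) U → 1 ≤ ∣ U ∣ → Removal U 1
  removeOne {U@(_ ∷ _ ∷ _ ∷ _ ∷ _ ∷ w)} conn 1≤∣U∣ = case ∣ U ∣ ≟ℕ 1 of λ where
    (yes ∣U∣≡1) → removeAll conn one ∣U∣≡1
    (no ∣U∣≢1)  → let 2≤∣U∣ = ≤∧≢⇒< 1≤∣U∣ (λ 1≡∣U∣ → ∣U∣≢1 (sym 1≡∣U∣)) in
                  case 1 ≤? ∣ w ∣ of λ where
                    (yes 1≤∣w∣) → let (_ , j∈U , mv) = removeTopLeg conn 2≤∣U∣ 1≤∣w∣ in removeVertex j∈U mv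
                    (no 1≰∣w∣)  → removeOffLeg conn 2≤∣U∣ 1≰∣w∣

  removeTipEdge : ∀ {b₀ b₁ b₂ b₃ b₄} {w : Subset (k + 0)} → let U = b₀ ∷ b₁ ∷ b₂ ∷ b₃ ∷ b₄ ∷ w in
                  Connected (Star k) U → claw U ≡ false → 5 ≤ ∣ U ∣ → ¬ 2 ≤ ∣ w ∣ → Removal U 2
  removeTipEdge {b₄ = true} conn _ 5≤∣U∣ _ =
    let (_ , adj , v∈U) = neighbourIn Adj-sym conn v₄∈ (≤-trans (s≤s (s≤s z≤n)) 5≤∣U∣)
        v₃∈U            = subst (_∈ _) (Adj-v₄ adj) v∈U
    in _ , remove-v₄v₃ conn v₄∈ v₃∈U , ∣p-x-y∣ v₄∈ (x∈p∧x≢y⇒x∈p-y {y = v₄} v₃∈U (λ ()))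
    where v₄∈ = there (there (there (there here)))
  removeTipEdge {b₀} {b₁} {b₂} {b₃} {false} {w} _ clawFree 5≤∣U∣ 2≰∣w∣ =
    ⊥-elim (n≮n 4 (≤-trans 5≤∣U∣ (≤-trans (clawFree-size b₀ b₁ b₂ b₃ w clawFree)
                                             (+-monoʳ-≤ 3 (<⇒≤pred (≰⇒> 2≰∣w∣))))))

  removeTwo : ∀ {U} → Connected (Star k) U → claw U ≡ false → mod3 ∣ U ∣ ≡ 2 → Removal U 2
  removeTwo {U@(_ ∷ _ ∷ _ ∷ _ ∷ _ ∷ w)} conn clawFree ∣U∣≡₃2 = case ∣ U ∣ ≟ℕ 2 of λ where
    (yes ∣U∣≡2) → removeAll conn two ∣U∣≡2
    (no ∣U∣≢2)  → let 5≤∣U∣ = mod3≡2⇒5≤ ∣U∣≡₃2 ∣U∣≢2 in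
                  case 2 ≤? ∣ w ∣ of λ where
                    (yes 2≤∣w∣) → let 3≤∣U∣ = ≤-trans (s≤s (s≤s (s≤s z≤n))) 5≤∣U∣
                                      (_ , _ , j∈U , j′∈U-j , mv) = removeTopLegs conn 3≤∣U∣ 2≤∣w∣
                                  in _ , mv , ∣p-x-y∣ j∈U j′∈U-j
                    (no 2≰∣w∣)  → removeTipEdge conn clawFree 5≤∣U∣ 2≰∣w∣

  pathOptions : ∀ {U} → Connected (Star k) U → claw U ≡ false → ∀ {h} → h < grundy U → Option U h
  pathOptions {U} conn clawFree {h} h< =
    go (mod3 ∣ U ∣) h refl (subst (h <_) (grundy-clawFree {U = U} clawFree) h<)
    where
    option : ∀ {U′ h} → Move (Star k) L124 U U′ → mod3 ∣ U′ ∣ ≡ h → Option U h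
    option {U′} mv@(U′⊆U , _) ∣U′∣≡₃h =
      U′ , mv , trans (grundy-clawFree {U = U′} (claw-antimono U′⊆U clawFree)) ∣U′∣≡₃h
    afterOne : ∀ {r} → mod3 ∣ U ∣ ≡ r → Removal U 1 → Option U (pred3 r)
    afterOne ∣U∣≡₃r (_ , mv , size) = option mv (mod3-pred size ∣U∣≡₃r)
    afterTwo : ∀ {r} → mod3 ∣ U ∣ ≡ r → Removal U 2 → Option U (pred3 (pred3 r))
    afterTwo ∣U∣≡₃r (_ , mv , size) = option mv (mod3-pred₂ size ∣U∣≡₃r)
    go : ∀ r h → mod3 ∣ U ∣ ≡ r → h < r → Option U h
    go 1 0 ∣U∣≡₃1 _ = afterOne ∣U∣≡₃1 (removeOne conn (mod3-positive ∣U∣≡₃1))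
    go 2 1 ∣U∣≡₃2 _ = afterOne ∣U∣≡₃2 (removeOne conn (mod3-positive ∣U∣≡₃2))
    go 2 0 ∣U∣≡₃2 _ = afterTwo ∣U∣≡₃2 (removeTwo conn clawFree ∣U∣≡₃2)
    go 0 _ _ ()
    go 1 (suc _) _ (s≤s ())
    go 2 (suc (suc _)) _ (s≤s (s≤s ()))
    go (suc (suc (suc _))) _ ∣U∣≡₃3+r _ = ⊥-elim (mod3≢3+ ∣ U ∣ ∣U∣≡₃3+r)

  remove-v₁ : ∀ {U} → Connected (Star k) U → v₁ ∈ U → Move (Star k) L124 U (U - v₁)
  remove-v₁ conn v₁∈U = removePendant conn v₁∈U (λ ()) v₁-pendant

  starOptions : ∀ {w : Subset (k + 0)} → let U = true ∷ true ∷ true ∷ true ∷ false ∷ w in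
                Connected (Star k) U → ∀ r h → mod3 ∣ U ∣ ≡ r → h < value true false r → Option U h
  starOptions {w} conn = go
    where
    U : Position k
    U = true ∷ true ∷ true ∷ true ∷ false ∷ w
    v₁∈U : v₁ ∈ U
    v₁∈U = there here
    ∣w∣≡₃2 : mod3 ∣ U ∣ ≡ 0 → mod3 ∣ w ∣ ≡ 2
    ∣w∣≡₃2 = mod3-pred {∣ w ∣} refl
    topLeg : mod3 ∣ U ∣ ≡ 0 → LegRemoval U → Option U 0
    topLeg ∣U∣≡₃0 (j , j∈U , mv) = U - leg j , mv , cong (value true false) (mod3-pred (∣p-x∣ j∈U) ∣U∣≡₃0)
    topLegs : mod3 ∣ U ∣ ≡ 0 → LegPairRemoval U → Option U 1
    topLegs ∣U∣≡₃0 (j , j′ , j∈U , j′∈U-j , mv) =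
      U - leg j - leg j′ , mv , cong (value true false) (mod3-pred₂ (∣p-x-y∣ j∈U j′∈U-j) ∣U∣≡₃0)
    go : ∀ r h → mod3 ∣ U ∣ ≡ r → h < value true false r → Option U h
    go 0 0 ∣U∣≡₃0 _ =
      topLeg ∣U∣≡₃0 (removeTopLeg conn (s≤s (s≤s z≤n)) (≤-trans (s≤s z≤n) (mod3≡2⇒2≤ (∣w∣≡₃2 ∣U∣≡₃0))))
    go 0 1 ∣U∣≡₃0 _ = topLegs ∣U∣≡₃0 (removeTopLegs conn (s≤s (s≤s (s≤s z≤n))) (mod3≡2⇒2≤ (∣w∣≡₃2 ∣U∣≡₃0)))
    go 0 2 ∣U∣≡₃0 _ = U - v₁ , remove-v₁ conn v₁∈U , mod3-pred (∣p-x∣ v₁∈U) ∣U∣≡₃0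
    go 1 0 ∣U∣≡₃1 _ = U - v₁ , remove-v₁ conn v₁∈U , mod3-pred (∣p-x∣ v₁∈U) ∣U∣≡₃1
    go 0 (suc (suc (suc _))) _ (s≤s (s≤s (s≤s ())))
    go 1 (suc _) _ (s≤s ())
    go 2 _ _ ()
    go (suc (suc (suc _))) _ ∣U∣≡₃3+r _ = ⊥-elim (mod3≢3+ ∣ U ∣ ∣U∣≡₃3+r)

  star⁺Options : ∀ {w : Subset (k + 0)} → let U = true ∷ true ∷ true ∷ true ∷ true ∷ w in
                 Connected (Star k) U → ∀ r h → mod3 ∣ U ∣ ≡ r → h < value true true r → Option U h
  star⁺Options {w} conn = go
    where
    U : Position k
    U = true ∷ true ∷ true ∷ true ∷ true ∷ w
    v₁∈U : v₁ ∈ U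
    v₁∈U = there here
    v₃∈U : v₃ ∈ U
    v₃∈U = there (there (there here))
    v₄∈U : v₄ ∈ U
    v₄∈U = there (there (there (there here)))
    v₃∈U-v₄ : v₃ ∈ U - v₄
    v₃∈U-v₄ = x∈p∧x≢y⇒x∈p-y {y = v₄} v₃∈U (λ ())
    go : ∀ r h → mod3 ∣ U ∣ ≡ r → h < value true true r → Option U h
    go 0 0 ∣U∣≡₃0 _ = U - v₄ , removePendant conn v₄∈U (λ ()) v₄-pendant ,
                      cong (value true false) (mod3-pred (∣p-x∣ v₄∈U) ∣U∣≡₃0)
    go 0 1 ∣U∣≡₃0 _ = U - v₄ - v₃ , remove-v₄v₃ conn v₄∈U v₃∈U , mod3-pred₂ (∣p-x-y∣ v₄∈U v₃∈U-v₄) ∣U∣≡₃0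
    go 0 2 ∣U∣≡₃0 _ = U - v₁ , remove-v₁ conn v₁∈U , mod3-pred (∣p-x∣ v₁∈U) ∣U∣≡₃0
    go 1 0 ∣U∣≡₃1 _ = U - v₁ , remove-v₁ conn v₁∈U , mod3-pred (∣p-x∣ v₁∈U) ∣U∣≡₃1
    go 2 0 ∣U∣≡₃2 _ = U - v₄ - v₃ , remove-v₄v₃ conn v₄∈U v₃∈U , mod3-pred₂ (∣p-x-y∣ v₄∈U v₃∈U-v₄) ∣U∣≡₃2
    go 2 1 ∣U∣≡₃2 _ = U - v₁ , remove-v₁ conn v₁∈U , mod3-pred (∣p-x∣ v₁∈U) ∣U∣≡₃2
    go 0 (suc (suc (suc _))) _ (s≤s (s≤s (s≤s ())))
    go 1 (suc _) _ (s≤s ())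
    go 2 (suc (suc _)) _ (s≤s (s≤s ()))
    go (suc (suc (suc _))) _ ∣U∣≡₃3+r _ = ⊥-elim (mod3≢3+ ∣ U ∣ ∣U∣≡₃3+r)

  centre∈claw : ∀ {b₀ b₄} {w : Subset (k + 0)} → Connected (Star k) (b₀ ∷ true ∷ true ∷ true ∷ b₄ ∷ w)
              → v₀ ∈ (b₀ ∷ true ∷ true ∷ true ∷ b₄ ∷ w)
  centre∈claw conn = case Reach-firstStep (conn v₁ v₂ (there here) (there (there here))) of λ where
    (inj₂ (_ , adj , v∈U)) → subst (_∈ _) (Adj-v₁ adj) v∈U

  grundy-options : ∀ {U} → Connected (Star k) U → ∀ {h} → h < grundy U → Option U h
  grundy-options {true ∷ true ∷ true ∷ true ∷ false ∷ _}  conn h< = starOptions conn _ _ refl h<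
  grundy-options {true ∷ true ∷ true ∷ true ∷ true ∷ _}   conn h< = star⁺Options conn _ _ refl h<
  grundy-options {false ∷ true ∷ true ∷ true ∷ _ ∷ _}     conn _  = case centre∈claw conn of λ ()
  grundy-options {_ ∷ false ∷ _ ∷ _ ∷ _ ∷ _}             conn h< = pathOptions conn refl h<
  grundy-options {_ ∷ true ∷ false ∷ _ ∷ _ ∷ _}          conn h< = pathOptions conn refl h<
  grundy-options {_ ∷ true ∷ true ∷ false ∷ _ ∷ _}       conn h< = pathOptions conn refl h<

Star-grundy : ∀ k → GrundyValue (Star k) L124 (grundy (⊤ {n (Star k)}))
Star-grundy k = isGrundy-byValue L124-positive grundy grundy-differs grundy-options Star-connected

grundy-⊤ : ∀ k → grundy (⊤ {n (Star k)}) ≡ value true true (mod3 (2 + k % 3))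
grundy-⊤ k = cong (value true true) (begin
  mod3 (2 + ∣ ⊤ {k + 0} ∣)  ≡⟨ cong (λ s → mod3 (2 + s)) (trans (∣⊤∣≡n (k + 0)) (+-identityʳ k)) ⟩
  mod3 (2 + k)              ≡⟨ mod3-2+ k ⟩
  mod3 (2 + mod3 k)         ≡⟨ cong (λ s → mod3 (2 + s)) (mod3≡%3 k) ⟩
  mod3 (2 + k % 3)          ∎)
  where open ≡-Reasoning

lemma24 : (k : ℕ)
    → (k % 3 ≡ 0 → GrundyValue (SubdividedStar (1 ∷ 1 ∷ 2 ∷ k ∷ [])) L124 2)
    × (k % 3 ≡ 1 → GrundyValue (SubdividedStar (1 ∷ 1 ∷ 2 ∷ k ∷ [])) L124 3)
    × (k % 3 ≡ 2 → GrundyValue (SubdividedStar (1 ∷ 1 ∷ 2 ∷ k ∷ [])) L124 1)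
lemma24 k = at , at , at
  where
  at : ∀ {r} → k % 3 ≡ r → GrundyValue (Star k) L124 (value true true (mod3 (2 + r)))
  at refl = subst (GrundyValue (Star k) L124) (grundy-⊤ k) (Star-grundy k)
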